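{- Let $n\ge 1$. The map $B\mapsto \mathrm{Odd}(B)=[n-1]\setminus (B\cup(B-1))$ is a bijection from the set of peak sets $B\subseteq\{2,3,\dots,n-1\}$ to the set of odd sets $A\subseteq[n-1]$.
   Context: $[m]=\{1,\dots,m\}$. A set $B\subseteq\{2,3,\dots,n-1\}$ is a peak set if $b\in B$ implies $\{b-1,b+1\}\cap B=\emptyset$. $B-1=\{b-1:b\in B\}$. A subset $A=\{a_1<\dots<a_k\}\subseteq[n-1]$ is an odd set if $a_i-a_{i-1}$ is odd for every $1\le i\le k+1$, where $a_0=0$ and $a_{k+1}=n$. -}

module Defs where

open import Data.Nat using (ℕ; zero; suc; _∸_; _%_)
open import Data.Bool using (true; false)
open import Data.List using (List; []; _∷_)
open import Data.Vec using (Vec; []; _∷_; _∷ʳ_)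
open import Data.Fin using (Fin; toℕ)
open import Data.Fin.Subset using (Subset; _∈_; _∉_; ∁; _∪_; outside)
open import Data.Product using (_×_)
open import Relation.Binary.PropositionalEquality using (_≡_)
open import Relation.Nullary using (¬_)

-- Convention: a subset of [m] = {1,…,m} is a  Subset m  (from Data.Fin.Subset);
-- the index  i : Fin m  represents the number  toℕ i + 1.
-- Subsets of [n-1] are thus  Subset (n ∸ 1).

elemsFrom : {m : ℕ} → ℕ → Subset m → List ℕ
elemsFrom k [] = []
elemsFrom k (true ∷ xs) = k ∷ elemsFrom (suc k) xs
elemsFrom k (false ∷ xs) = elemsFrom (suc k) xs

elems : {m : ℕ} → Subset m → List ℕ
elems = elemsFrom 1

IsPeakSet : (n : ℕ) → Subset (n ∸ 1) → Set
IsPeakSet n B =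
  ((i : Fin (n ∸ 1)) → i ∈ B → ¬ (toℕ i ≡ 0))
  × ((i j : Fin (n ∸ 1)) → i ∈ B → toℕ j ≡ suc (toℕ i) → j ∉ B)
  × ((i j : Fin (n ∸ 1)) → i ∈ B → suc (toℕ j) ≡ toℕ i → j ∉ B)

-- B - 1 = {b - 1 : b ∈ B}, intersected with [m]
-- (k ∈ B-1 iff k+1 ∈ B; the element 0 = 1 - 1 is outside [m] and dropped)
minus1 : {m : ℕ} → Subset m → Subset m
minus1 [] = []
minus1 (x ∷ xs) = xs ∷ʳ outside

Odd : (n : ℕ) → Subset (n ∸ 1) → Subset (n ∸ 1)
Odd n B = ∁ (B ∪ minus1 B)

OddNat : ℕ → Set
OddNat k = k % 2 ≡ 1

-- gaps a_i - a_{i-1} odd for a list a_1<…<a_k, with a_0 = prev, a_{k+1} = n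
OddGaps : ℕ → List ℕ → ℕ → Set
OddGaps prev [] n = OddNat (n ∸ prev)
OddGaps prev (a ∷ as) n = OddNat (a ∸ prev) × OddGaps a as n

IsOddSet : (n : ℕ) → Subset (n ∸ 1) → Set
IsOddSet n A = OddGaps 0 (elems A) n

-- Read a subset of [n-1] as a word of bits. B is a peak set exactly when its first bit is 0 and it
-- has no two consecutive 1s; then B ∪ (B - 1) is B with every factor 01 turned into 11, a disjoint
-- union of blocks of two consecutive positions. So between consecutive elements of its complement
-- Odd(B) lie an even number of non-elements, i.e. all gaps are odd. Conversely the non-elements of
-- an odd set A split uniquely into such pairs, and B is the set of second positions of the pairs.
module Submission where

open import Defs
open import Data.Nat using (ℕ; _≤_; _∸_; zero; suc; _+_; _%_; pred)
open import Data.Nat.Properties using (+-comm; +-suc; +-identityʳ; m+n∸m≡n)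
open import Data.Nat.DivMod using ([m+n]%n≡m%n)
open import Data.Bool using (Bool; true; false; not; _∧_; _∨_)
open import Data.Vec using ([]; _∷_; here; there)
open import Data.Fin using (Fin; toℕ; zero; suc)
open import Data.Fin.Subset using (Subset; ∁; _∪_; _∈_; _∉_)
open import Data.Product using (Σ; _×_; _,_)
open import Data.Unit using (⊤; tt)
open import Data.Empty using (⊥-elim)
open import Relation.Binary.PropositionalEquality
  using (_≡_; _≢_; refl; sym; trans; cong; subst; module ≡-Reasoning)

first : ∀ {m} → Subset m → Bool
first [] = false
first (x ∷ _) = x

minus1-∷ : ∀ {m} (x : Bool) (xs : Subset m) → minus1 (x ∷ xs) ≡ first xs ∷ minus1 xs
minus1-∷ x [] = refl
minus1-∷ x (y ∷ ys) = refl

odd′ : ∀ {m} → Subset m → Subset m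
odd′ [] = []
odd′ (x ∷ xs) = not (x ∨ first xs) ∷ odd′ xs

∁-∪-minus1≡odd′ : ∀ {m} (B : Subset m) → ∁ (B ∪ minus1 B) ≡ odd′ B
∁-∪-minus1≡odd′ [] = refl
∁-∪-minus1≡odd′ (x ∷ xs) rewrite minus1-∷ x xs = cong (not (x ∨ first xs) ∷_) (∁-∪-minus1≡odd′ xs)

-- b is the bit preceding the word; peak sets are the words Spaced after a 1.
Spaced : ∀ {m} → Bool → Subset m → Set
Spaced b [] = ⊤
Spaced b (x ∷ xs) = b ∧ x ≡ false × Spaced x xs

Spaced-weaken : ∀ {m} (B : Subset m) → Spaced true B → Spaced false B
Spaced-weaken [] s = s
Spaced-weaken (false ∷ xs) s = s

NoAdjacent : ∀ {m} → Subset m → Set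
NoAdjacent {m} B = (i j : Fin m) → i ∈ B → toℕ j ≡ suc (toℕ i) → j ∉ B

NoAdjacent-tail : ∀ {m} x (xs : Subset m) → NoAdjacent (x ∷ xs) → NoAdjacent xs
NoAdjacent-tail x xs adj i j i∈ j≡ j∈ = adj (suc i) (suc j) (there i∈) (cong suc j≡) (there j∈)

Spaced⇒NoAdjacent : ∀ {m} b (B : Subset m) → Spaced b B → NoAdjacent B
Spaced⇒NoAdjacent b (x ∷ y ∷ xs) (_ , () , _) zero (suc zero) here refl (there here)
Spaced⇒NoAdjacent b (x ∷ xs) (_ , s) (suc i) (suc j) (there i∈) j≡ (there j∈) =
  Spaced⇒NoAdjacent x xs s i j i∈ (cong pred j≡) j∈

NoAdjacent⇒Spaced : ∀ {m} b (B : Subset m) → b ∧ first B ≡ false → NoAdjacent B → Spaced b B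
NoAdjacent⇒Spaced b [] _ _ = tt
NoAdjacent⇒Spaced b (true ∷ []) bx _ = bx , tt
NoAdjacent⇒Spaced b (true ∷ true ∷ xs) _ adj = ⊥-elim (adj zero (suc zero) here refl (there here))
NoAdjacent⇒Spaced b (true ∷ false ∷ xs) bx adj =
  bx , NoAdjacent⇒Spaced true (false ∷ xs) refl (NoAdjacent-tail true (false ∷ xs) adj)
NoAdjacent⇒Spaced b (false ∷ xs) bx adj = bx , NoAdjacent⇒Spaced false xs refl (NoAdjacent-tail false xs adj)

IsPeakSet⇒Spaced : ∀ {m} (B : Subset m) → IsPeakSet (suc m) B → Spaced true B
IsPeakSet⇒Spaced [] _ = tt
IsPeakSet⇒Spaced (true ∷ xs) (1∉B , _) = ⊥-elim (1∉B zero here refl)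
IsPeakSet⇒Spaced (false ∷ xs) (_ , adj , _) = NoAdjacent⇒Spaced true (false ∷ xs) refl adj

Spaced⇒IsPeakSet : ∀ {m} (B : Subset m) → Spaced true B → IsPeakSet (suc m) B
Spaced⇒IsPeakSet B s = 1∉B B s , adj , λ i j i∈ j≡ j∈ → adj j i j∈ (sym j≡) i∈
  where
  adj : NoAdjacent B
  adj = Spaced⇒NoAdjacent true B s
  1∉B : ∀ {m} (B : Subset m) → Spaced true B → (i : Fin m) → i ∈ B → toℕ i ≢ 0
  1∉B (true ∷ xs) (() , _) zero here
  1∉B (x ∷ xs) _ (suc i) _ ()

-- In GapsOdd d A, the last element of the odd set preceding A lies d + 1 positions before A.
GapsOdd : ∀ {m} → ℕ → Subset m → Set
GapsOdd d [] = OddNat (suc d)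
GapsOdd d (true ∷ xs) = OddNat (suc d) × GapsOdd 0 xs
GapsOdd d (false ∷ xs) = GapsOdd (suc d) xs

OddNat-suc-suc : ∀ k → OddNat (suc (suc k)) ≡ OddNat k
OddNat-suc-suc k = cong (_≡ 1) (trans (cong (_% 2) (+-comm 2 k)) ([m+n]%n≡m%n k 2))

GapsOdd-suc-suc : ∀ {m} d (A : Subset m) → GapsOdd (suc (suc d)) A ≡ GapsOdd d A
GapsOdd-suc-suc d [] = OddNat-suc-suc (suc d)
GapsOdd-suc-suc d (true ∷ xs) = cong (_× GapsOdd 0 xs) (OddNat-suc-suc (suc d))
GapsOdd-suc-suc d (false ∷ xs) = GapsOdd-suc-suc (suc d) xs

OddGaps≡GapsOdd : ∀ {k} (A : Subset k) p d j N → j ≡ p + suc d → N ≡ j + k →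
                  OddGaps p (elemsFrom j A) N ≡ GapsOdd d A
OddGaps≡GapsOdd [] p d _ _ refl refl rewrite +-identityʳ (p + suc d) | m+n∸m≡n p (suc d) = refl
OddGaps≡GapsOdd {suc k} (true ∷ xs) p d _ _ refl refl rewrite m+n∸m≡n p (suc d) =
  cong (OddNat (suc d) ×_)
    (OddGaps≡GapsOdd xs (p + suc d) 0 _ _ (sym (+-comm (p + suc d) 1)) (+-suc (p + suc d) k))
OddGaps≡GapsOdd {suc k} (false ∷ xs) p d _ _ refl refl =
  OddGaps≡GapsOdd xs p (suc d) _ _ (sym (+-suc p (suc d))) (+-suc (p + suc d) k)

odd⁻¹ : ∀ {m} → Subset m → Subset m
odd⁻¹ [] = []
odd⁻¹ (true ∷ xs) = false ∷ odd⁻¹ xs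
odd⁻¹ (false ∷ []) = false ∷ []
odd⁻¹ (false ∷ x ∷ xs) = false ∷ true ∷ odd⁻¹ xs

first-odd⁻¹ : ∀ {m} (A : Subset m) → first (odd⁻¹ A) ≡ false
first-odd⁻¹ [] = refl
first-odd⁻¹ (true ∷ xs) = refl
first-odd⁻¹ (false ∷ []) = refl
first-odd⁻¹ (false ∷ x ∷ xs) = refl

odd′-GapsOdd : ∀ {m} (B : Subset m) → Spaced true B → GapsOdd 0 (odd′ B)
odd′-GapsOdd [] _ = refl
odd′-GapsOdd (false ∷ []) _ = refl , refl
odd′-GapsOdd (false ∷ false ∷ xs) (_ , s) = refl , odd′-GapsOdd (false ∷ xs) s
odd′-GapsOdd (false ∷ true ∷ xs) (_ , _ , s) =
  subst (λ P → P) (sym (GapsOdd-suc-suc 0 (odd′ xs))) (odd′-GapsOdd xs s)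

odd⁻¹-odd′ : ∀ {m} (B : Subset m) → Spaced true B → odd⁻¹ (odd′ B) ≡ B
odd⁻¹-odd′ [] _ = refl
odd⁻¹-odd′ (false ∷ []) _ = refl
odd⁻¹-odd′ (false ∷ false ∷ xs) (_ , s) = cong (false ∷_) (odd⁻¹-odd′ (false ∷ xs) s)
odd⁻¹-odd′ (false ∷ true ∷ xs) (_ , _ , s) = cong (λ ys → false ∷ true ∷ ys) (odd⁻¹-odd′ xs s)

odd⁻¹-Spaced : ∀ {m} (A : Subset m) → GapsOdd 0 A → Spaced true (odd⁻¹ A)
odd⁻¹-Spaced [] _ = tt
odd⁻¹-Spaced (true ∷ xs) (_ , g) = refl , Spaced-weaken (odd⁻¹ xs) (odd⁻¹-Spaced xs g)
odd⁻¹-Spaced (false ∷ false ∷ xs) g =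
  refl , refl , odd⁻¹-Spaced xs (subst (λ P → P) (GapsOdd-suc-suc 0 xs) g)

odd′-odd⁻¹ : ∀ {m} (A : Subset m) → GapsOdd 0 A → odd′ (odd⁻¹ A) ≡ A
odd′-odd⁻¹ [] _ = refl
odd′-odd⁻¹ (true ∷ xs) (_ , g) rewrite first-odd⁻¹ xs = cong (true ∷_) (odd′-odd⁻¹ xs g)
odd′-odd⁻¹ (false ∷ false ∷ xs) g =
  cong (λ ys → false ∷ false ∷ ys) (odd′-odd⁻¹ xs (subst (λ P → P) (GapsOdd-suc-suc 0 xs) g))

proposition3p1 : (n : ℕ) → 1 ≤ n →
    ((B : Subset (n ∸ 1)) → IsPeakSet n B → IsOddSet n (Odd n B))
    × ((B B′ : Subset (n ∸ 1)) → IsPeakSet n B → IsPeakSet n B′ → Odd n B ≡ Odd n B′ → B ≡ B′)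
    × ((A : Subset (n ∸ 1)) → IsOddSet n A → Σ (Subset (n ∸ 1)) (λ B → IsPeakSet n B × Odd n B ≡ A))
proposition3p1 (suc m) _ = odd-isOdd , odd-injective , odd-surjective
  where
  isOdd≡GapsOdd : (A : Subset m) → IsOddSet (suc m) A ≡ GapsOdd 0 A
  isOdd≡GapsOdd A = OddGaps≡GapsOdd A 0 0 1 (suc m) refl refl

  odd-isOdd : (B : Subset m) → IsPeakSet (suc m) B → IsOddSet (suc m) (Odd (suc m) B)
  odd-isOdd B p rewrite ∁-∪-minus1≡odd′ B | isOdd≡GapsOdd (odd′ B) =
    odd′-GapsOdd B (IsPeakSet⇒Spaced B p)

  odd-injective : (B B′ : Subset m) → IsPeakSet (suc m) B → IsPeakSet (suc m) B′ →
                  Odd (suc m) B ≡ Odd (suc m) B′ → B ≡ B′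
  odd-injective B B′ p p′ eq = begin
    B                 ≡⟨ sym (odd⁻¹-odd′ B (IsPeakSet⇒Spaced B p)) ⟩
    odd⁻¹ (odd′ B)    ≡⟨ cong odd⁻¹ (trans (sym (∁-∪-minus1≡odd′ B)) (trans eq (∁-∪-minus1≡odd′ B′))) ⟩
    odd⁻¹ (odd′ B′)   ≡⟨ odd⁻¹-odd′ B′ (IsPeakSet⇒Spaced B′ p′) ⟩
    B′                ∎
    where open ≡-Reasoning

  odd-surjective : (A : Subset m) → IsOddSet (suc m) A →
                   Σ (Subset m) (λ B → IsPeakSet (suc m) B × Odd (suc m) B ≡ A)
  odd-surjective A o =
    odd⁻¹ A , Spaced⇒IsPeakSet (odd⁻¹ A) (odd⁻¹-Spaced A g) , trans (∁-∪-minus1≡odd′ (odd⁻¹ A)) (odd′-odd⁻¹ A g)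
    where
    g : GapsOdd 0 A
    g = subst (λ P → P) (isOdd≡GapsOdd A) o
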